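{- Let $M$ and $N$ be finite $R$-modules and $A\subseteq R$. Then $C_A(M\times N)\ge C_A(M)\,C_A(N)$.
   Context: $R$ is a ring with unity. For a finite $R$-module $M$, $A\subseteq R$ and a sequence $(x_1,\ldots,x_k)$ in $M$, an $A$-weighted zero-sum subsequence of consecutive terms is given by a non-empty set $I\subseteq[1,k]$ of consecutive integers and $a_i\in A$ ($i\in I$) with $\sum_{i\in I}a_ix_i=0$. $C_A(M)$ is the least positive integer $k$ such that every sequence in $M$ of length $k$ has an $A$-weighted zero-sum subsequence of consecutive terms. -}

module Defs where

open import Level using (Level; _⊔_)
open import Data.Nat using (ℕ; zero; suc; _<_; _≤_; _*_)
open import Data.Fin using (Fin)
open import Data.List using (List; []; _∷_; _++_; length; map)
open import Data.List.Relation.Unary.All using (All)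
open import Data.Product using (Σ; ∃; _×_; _,_; proj₁; proj₂)
open import Relation.Binary.PropositionalEquality using (_≡_)
open import Relation.Unary using (Pred)
open import Relation.Nullary using (¬_)
open import Algebra.Bundles using (Ring)
open import Algebra.Module.Bundles using (LeftModule)

module _ {r ℓr m ℓm : Level} {R : Ring r ℓr} (M : LeftModule R m ℓm) where
  open Ring R using () renaming (Carrier to Rc)
  open LeftModule M

  IsFiniteModule : Set (m ⊔ ℓm)
  IsFiniteModule = Σ ℕ λ n → Σ (Fin n → Carrierᴹ) λ f → ∀ x → Σ (Fin n) λ i → f i ≈ᴹ x

  wsum : List (Rc × Carrierᴹ) → Carrierᴹ
  wsum []             = 0ᴹ
  wsum ((a , x) ∷ ps) = (a *ₗ x) +ᴹ wsum ps

  HasConsecZeroSum : {a : Level} → Pred Rc a → List Carrierᴹ → Set (r ⊔ m ⊔ ℓm ⊔ a)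
  HasConsecZeroSum A xs =
    Σ (List Carrierᴹ) λ pre → Σ (List Carrierᴹ) λ mid → Σ (List Carrierᴹ) λ suf →
      xs ≡ pre ++ mid ++ suf × 0 < length mid ×
      Σ (List (Rc × Carrierᴹ)) λ ps →
        map proj₂ ps ≡ mid × All (λ p → A (proj₁ p)) ps × wsum ps ≈ᴹ 0ᴹ

  AllHaveZS : {a : Level} → Pred Rc a → ℕ → Set (r ⊔ m ⊔ ℓm ⊔ a)
  AllHaveZS A k = (xs : List Carrierᴹ) → length xs ≡ k → HasConsecZeroSum A xs

  IsC : {a : Level} → Pred Rc a → ℕ → Set (r ⊔ m ⊔ ℓm ⊔ a)
  IsC A c = 0 < c × AllHaveZS A c × (∀ k → 0 < k → k < c → ¬ AllHaveZS A k)

{-# OPTIONS --safe #-}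
-- Let xs be a zero-sum-free sequence of length p = C_A(M) - 1 in M and ys one of length
-- q = C_A(N) - 1 in N. With Y = (0,y₁) … (0,y_q), the sequence
--   Y (x₁,0) Y (x₂,0) Y … (x_p,0) Y
-- in M × N has length q + p(q + 1) = C_A(M) C_A(N) - 1 and no A-weighted zero-sum block:
-- the N-component of a block inside one copy of Y is a weighted sum of a run of ys, and
-- every other block contains some (x_i,0), so its M-component is a weighted sum of a run
-- of xs starting at x_i.
module Submission where

open import Defs
open import Level using (Level; _⊔_)
open import Function using (_∘_)
open import Data.Nat
  using (ℕ; zero; suc; _<_; _≤_; _*_; _+_; _≤′_; ≤′-refl; ≤′-step; _≤?_; s≤s; z≤n)
open import Data.Nat.Properties using (suc-injective; n<1+n; ≰⇒>; ≤-pred; ≤⇒≤′)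
open import Data.Fin using (Fin; zero; suc)
open import Data.List using (List; []; _∷_; _++_; length; map)
open import Data.List.Properties using (length-map; length-++)
open import Data.List.Relation.Unary.All using (All; []; _∷_)
open import Data.List.Relation.Binary.Pointwise using (Pointwise; []; _∷_)
open import Data.Product using (Σ; _×_; _,_; proj₁; proj₂)
open import Data.Sum using (_⊎_; inj₁; inj₂; [_,_])
import Data.Sum as Sum
open import Relation.Binary.PropositionalEquality using (_≡_; refl; trans; cong; cong₂)
open import Relation.Unary using (Pred)
open import Relation.Nullary using (¬_)
open import Relation.Nullary.Decidable using (decidable-stable)
open import Algebra.Bundles using (Ring)
open import Algebra.Module.Bundles using (LeftModule)
open import Algebra.Module.Construct.DirectProduct using (leftModule)

¬¬-∀-Fin : ∀ {ℓ n} {Q : Fin n → Set ℓ} → (∀ i → ¬ ¬ Q i) → ¬ ¬ (∀ i → Q i)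
¬¬-∀-Fin {n = zero}  _   ¬∀ = ¬∀ (λ ())
¬¬-∀-Fin {n = suc n} ¬¬Q ¬∀ =
  ¬¬Q zero λ q₀ → ¬¬-∀-Fin (¬¬Q ∘ suc) λ qs → ¬∀ λ { zero → q₀ ; (suc i) → qs i }

¬¬-∀-ofLength : ∀ {ℓ n} k {P : List (Fin n) → Set ℓ} →
  (∀ is → length is ≡ k → ¬ ¬ P is) → ¬ ¬ (∀ is → length is ≡ k → P is)
¬¬-∀-ofLength zero    ¬¬P ¬∀ = ¬¬P [] refl λ p → ¬∀ λ { [] _ → p ; (_ ∷ _) () }
¬¬-∀-ofLength (suc k) ¬¬P ¬∀ =
  ¬¬-∀-Fin (λ i → ¬¬-∀-ofLength k λ is |is| → ¬¬P (i ∷ is) (cong suc |is|))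
    λ ∀P → ¬∀ λ { (i ∷ is) |i∷is| → ∀P i is (suc-injective |i∷is|) ; [] () }

module WeightedSums {r ℓr m ℓm a : Level} {R : Ring r ℓr} (M : LeftModule R m ℓm)
                    (A : Pred (Ring.Carrier R) a) where
  open Ring R using () renaming (Carrier to Rc)
  open LeftModule M

  data PrefixSum  (xs : List Carrierᴹ) (s : Carrierᴹ) : Set (r ⊔ m ⊔ ℓm ⊔ a)
  data PrefixSum⁺ : List Carrierᴹ → Carrierᴹ → Set (r ⊔ m ⊔ ℓm ⊔ a)

  data PrefixSum xs s where
    empty    : 0ᴹ ≈ᴹ s → PrefixSum xs s
    nonempty : PrefixSum⁺ xs s → PrefixSum xs s

  data PrefixSum⁺ where
    cons : ∀ {c x xs t s} → A c → PrefixSum xs t → (c *ₗ x) +ᴹ t ≈ᴹ s → PrefixSum⁺ (x ∷ xs) s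

  data ConsecZeroSum : List Carrierᴹ → Set (r ⊔ m ⊔ ℓm ⊔ a) where
    here  : ∀ {xs} → PrefixSum⁺ xs 0ᴹ → ConsecZeroSum xs
    there : ∀ {x xs} → ConsecZeroSum xs → ConsecZeroSum (x ∷ xs)

  ¬consecZeroSum-[] : ¬ ConsecZeroSum []
  ¬consecZeroSum-[] (here ())

  *ₗ-zeroʳ-+ᴹ : ∀ {c t s} → (c *ₗ 0ᴹ) +ᴹ t ≈ᴹ s → t ≈ᴹ s
  *ₗ-zeroʳ-+ᴹ {c} {t} eq =
    ≈ᴹ-trans (≈ᴹ-sym (+ᴹ-identityˡ t)) (≈ᴹ-trans (+ᴹ-congʳ (≈ᴹ-sym (*ₗ-zeroʳ c))) eq)

  prefixSum⁺-resp : ∀ {xs t s} → t ≈ᴹ s → PrefixSum⁺ xs t → PrefixSum⁺ xs s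
  prefixSum⁺-resp t≈s (cons c p e) = cons c p (≈ᴹ-trans e t≈s)

  prefixSum-resp : ∀ {xs t s} → t ≈ᴹ s → PrefixSum xs t → PrefixSum xs s
  prefixSum-resp t≈s (empty e)    = empty (≈ᴹ-trans e t≈s)
  prefixSum-resp t≈s (nonempty p) = nonempty (prefixSum⁺-resp t≈s p)

  prefixSum-pointwise  : ∀ {xs ys s} → Pointwise _≈ᴹ_ xs ys → PrefixSum xs s → PrefixSum ys s
  prefixSum⁺-pointwise : ∀ {xs ys s} → Pointwise _≈ᴹ_ xs ys → PrefixSum⁺ xs s → PrefixSum⁺ ys s
  prefixSum-pointwise xs≈ys (empty e)    = empty e
  prefixSum-pointwise xs≈ys (nonempty p) = nonempty (prefixSum⁺-pointwise xs≈ys p)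
  prefixSum⁺-pointwise (x≈y ∷ xs≈ys) (cons c p e) =
    cons c (prefixSum-pointwise xs≈ys p) (≈ᴹ-trans (+ᴹ-congʳ (*ₗ-congˡ (≈ᴹ-sym x≈y))) e)

  consecZeroSum-pointwise : ∀ {xs ys} → Pointwise _≈ᴹ_ xs ys → ConsecZeroSum xs → ConsecZeroSum ys
  consecZeroSum-pointwise xs≈ys        (here p)  = here (prefixSum⁺-pointwise xs≈ys p)
  consecZeroSum-pointwise (_ ∷ xs≈ys) (there z) = there (consecZeroSum-pointwise xs≈ys z)

  prefixSum-weights : ∀ ps suf → All (A ∘ proj₁) ps → PrefixSum (map proj₂ ps ++ suf) (wsum M ps)
  prefixSum-weights []       suf []         = empty ≈ᴹ-refl
  prefixSum-weights (_ ∷ ps) suf (Ac ∷ Aps) =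
    nonempty (cons Ac (prefixSum-weights ps suf Aps) ≈ᴹ-refl)

  consecZeroSum-++⁺ʳ : ∀ pre {xs} → ConsecZeroSum xs → ConsecZeroSum (pre ++ xs)
  consecZeroSum-++⁺ʳ []        z = z
  consecZeroSum-++⁺ʳ (_ ∷ pre) z = there (consecZeroSum-++⁺ʳ pre z)

  hasConsecZeroSum⇒ : ∀ {xs} → HasConsecZeroSum M A xs → ConsecZeroSum xs
  hasConsecZeroSum⇒ (pre , _ , suf , refl , () , [] , refl , _)
  hasConsecZeroSum⇒ (pre , _ , suf , refl , _ , (_ ∷ ps) , refl , Ac ∷ Aps , w) =
    consecZeroSum-++⁺ʳ pre (here (cons Ac (prefixSum-weights ps suf Aps) w))

  Weights : List Carrierᴹ → Carrierᴹ → List (Rc × Carrierᴹ) → Set (r ⊔ m ⊔ ℓm ⊔ a)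
  Weights xs s ps = Σ (List Carrierᴹ) λ suf →
    xs ≡ map proj₂ ps ++ suf × All (A ∘ proj₁) ps × wsum M ps ≈ᴹ s

  weightsOf  : ∀ {xs s} → PrefixSum xs s → Σ (List (Rc × Carrierᴹ)) (Weights xs s)
  weightsOf⁺ : ∀ {xs s} → PrefixSum⁺ xs s →
    Σ (Rc × Carrierᴹ) λ p → Σ (List (Rc × Carrierᴹ)) λ ps → Weights xs s (p ∷ ps)
  weightsOf {xs} (empty e) = [] , xs , refl , [] , e
  weightsOf (nonempty q) with weightsOf⁺ q
  ... | p , ps , w = p ∷ ps , w
  weightsOf⁺ (cons {c} {x} Ac q e) with weightsOf q
  ... | ps , suf , refl , Aps , w = (c , x) , ps , suf , refl , Ac ∷ Aps , ≈ᴹ-trans (+ᴹ-congˡ w) e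

  hasConsecZeroSum⇐ : ∀ {xs} → ConsecZeroSum xs → HasConsecZeroSum M A xs
  hasConsecZeroSum⇐ (here q) with weightsOf⁺ q
  ... | p , ps , suf , refl , Aps , w =
    [] , map proj₂ (p ∷ ps) , suf , refl , s≤s z≤n , p ∷ ps , refl , Aps , w
  hasConsecZeroSum⇐ {x ∷ _} (there z) with hasConsecZeroSum⇐ z
  ... | pre , mid , suf , eq , rest = x ∷ pre , mid , suf , cong (x ∷_) eq , rest

  allHaveZS-suc : ∀ {k} → AllHaveZS M A k → AllHaveZS M A (suc k)
  allHaveZS-suc all (_ ∷ xs) |x∷xs| =
    hasConsecZeroSum⇐ (there (hasConsecZeroSum⇒ (all xs (suc-injective |x∷xs|))))

  allHaveZS-mono : ∀ {k l} → k ≤ l → AllHaveZS M A k → AllHaveZS M A l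
  allHaveZS-mono = go ∘ ≤⇒≤′
    where
    go : ∀ {k l} → k ≤′ l → AllHaveZS M A k → AllHaveZS M A l
    go ≤′-refl        all = all
    go (≤′-step k≤′l) all = allHaveZS-suc (go k≤′l all)

  isC⇒¬allHaveZS : ∀ {c k} → IsC M A c → k < c → ¬ AllHaveZS M A k
  isC⇒¬allHaveZS {k = zero}  _                 _   all =
    ¬consecZeroSum-[] (hasConsecZeroSum⇒ (all [] refl))
  isC⇒¬allHaveZS {k = suc k} (_ , _ , minimal) k<c = minimal (suc k) (s≤s z≤n) k<c

  -- A is an arbitrary predicate, so ConsecZeroSum is not decidable and finiteness
  -- of M only produces a zero-sum-free witness under double negation.
  zeroSumFree-¬¬ : IsFiniteModule M → ∀ {k} → ¬ AllHaveZS M A k →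
    ¬ ¬ (Σ (List Carrierᴹ) λ xs → length xs ≡ k × ¬ ConsecZeroSum xs)
  zeroSumFree-¬¬ (n , f , cover) {k} ¬all ¬witness =
    ¬¬-∀-ofLength k (λ is |is| ¬z → ¬witness (map f is , trans (length-map f is) |is| , ¬z))
      λ all → ¬all λ xs |xs| → hasConsecZeroSum⇐ (consecZeroSum-pointwise (covered xs)
        (all (map index xs) (trans (length-map index xs) |xs|)))
    where
    index : Carrierᴹ → Fin n
    index = proj₁ ∘ cover

    covered : ∀ xs → Pointwise _≈ᴹ_ (map f (map index xs)) xs
    covered []       = []
    covered (x ∷ xs) = proj₂ (cover x) ∷ covered xs

module Interleaving {r ℓr m ℓm n ℓn a : Level} {R : Ring r ℓr}
    (M : LeftModule R m ℓm) (N : LeftModule R n ℓn) (A : Pred (Ring.Carrier R) a) where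
  private
    module M = LeftModule M
    module N = LeftModule N
    module ZM = WeightedSums M A
    module ZN = WeightedSums N A
    module Z× = WeightedSums (leftModule M N) A

  ι₁ : M.Carrierᴹ → M.Carrierᴹ × N.Carrierᴹ
  ι₁ x = x , N.0ᴹ

  ι₂ : N.Carrierᴹ → M.Carrierᴹ × N.Carrierᴹ
  ι₂ y = M.0ᴹ , y

  module _ (ys : List N.Carrierᴹ) where

    separate : List M.Carrierᴹ → List (M.Carrierᴹ × N.Carrierᴹ)
    separate []       = []
    separate (x ∷ xs) = ι₁ x ∷ map ι₂ ys ++ separate xs

    fromBlock : List N.Carrierᴹ → List M.Carrierᴹ → List (M.Carrierᴹ × N.Carrierᴹ)
    fromBlock ys′ xs = map ι₂ ys′ ++ separate xs

    interleave : List M.Carrierᴹ → List (M.Carrierᴹ × N.Carrierᴹ)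
    interleave = fromBlock ys

    length-separate   : ∀ xs → length (separate xs) ≡ length xs * suc (length ys)
    length-interleave : ∀ xs → length (interleave xs) ≡ length ys + length xs * suc (length ys)
    length-separate []       = refl
    length-separate (x ∷ xs) = cong suc (length-interleave xs)
    length-interleave xs =
      trans (length-++ (map ι₂ ys)) (cong₂ _+_ (length-map ι₂ ys) (length-separate xs))

    -- Every suffix of interleave xs is fromBlock ys′ xs′ with ys′ a suffix of ys and xs′ one of xs.
    prefixSum-proj₁  : ∀ xs ys′ {s} → Z×.PrefixSum (fromBlock ys′ xs) s → ZM.PrefixSum xs (proj₁ s)
    prefixSum⁺-proj₁ : ∀ xs ys′ {s} → Z×.PrefixSum⁺ (fromBlock ys′ xs) s → ZM.PrefixSum xs (proj₁ s)
    separate-prefixSum⁺ : ∀ xs {s} → Z×.PrefixSum⁺ (separate xs) s → ZM.PrefixSum⁺ xs (proj₁ s)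
    prefixSum-proj₁ xs ys′ (Z×.empty e)    = ZM.empty (proj₁ e)
    prefixSum-proj₁ xs ys′ (Z×.nonempty p) = prefixSum⁺-proj₁ xs ys′ p
    prefixSum⁺-proj₁ xs []        p = ZM.nonempty (separate-prefixSum⁺ xs p)
    prefixSum⁺-proj₁ xs (_ ∷ ys′) (Z×.cons _ p e) =
      ZM.prefixSum-resp (ZM.*ₗ-zeroʳ-+ᴹ (proj₁ e)) (prefixSum-proj₁ xs ys′ p)
    separate-prefixSum⁺ (_ ∷ xs) (Z×.cons Ac p e) =
      ZM.cons Ac (prefixSum-proj₁ xs ys p) (proj₁ e)

    prefixSum⁺-split : ∀ xs ys′ {s} → Z×.PrefixSum⁺ (fromBlock ys′ xs) s →
      ZN.PrefixSum⁺ ys′ (proj₂ s) ⊎ ZM.PrefixSum⁺ xs (proj₁ s)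
    prefixSum⁺-split xs []        p = inj₂ (separate-prefixSum⁺ xs p)
    prefixSum⁺-split xs (_ ∷ ys′) (Z×.cons Ac (Z×.empty e₀) e) =
      inj₁ (ZN.cons Ac (ZN.empty (proj₂ e₀)) (proj₂ e))
    prefixSum⁺-split xs (_ ∷ ys′) (Z×.cons Ac (Z×.nonempty p) e) =
      Sum.map (λ q → ZN.cons Ac (ZN.nonempty q) (proj₂ e))
              (ZM.prefixSum⁺-resp (ZM.*ₗ-zeroʳ-+ᴹ (proj₁ e)))
              (prefixSum⁺-split xs ys′ p)

    ¬consecZeroSum-fromBlock : ¬ ZN.ConsecZeroSum ys → ∀ xs ys′ →
      ¬ ZM.ConsecZeroSum xs → ¬ ZN.ConsecZeroSum ys′ → ¬ Z×.ConsecZeroSum (fromBlock ys′ xs)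
    ¬consecZeroSum-fromBlock ¬zys xs (_ ∷ ys′) ¬zxs ¬zys′ (Z×.there z) =
      ¬consecZeroSum-fromBlock ¬zys xs ys′ ¬zxs (¬zys′ ∘ ZN.there) z
    ¬consecZeroSum-fromBlock ¬zys (_ ∷ xs) [] ¬zxs _ (Z×.there z) =
      ¬consecZeroSum-fromBlock ¬zys xs ys (¬zxs ∘ ZM.there) ¬zys z
    ¬consecZeroSum-fromBlock ¬zys xs ys′ ¬zxs ¬zys′ (Z×.here p) =
      [ ¬zys′ ∘ ZN.here , ¬zxs ∘ ZM.here ] (prefixSum⁺-split xs ys′ p)

  ¬allHaveZS-× : IsFiniteModule M → IsFiniteModule N → ∀ {p q} →
    ¬ AllHaveZS M A p → ¬ AllHaveZS N A q → ¬ AllHaveZS (leftModule M N) A (q + p * suc q)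
  ¬allHaveZS-× finM finN ¬allM ¬allN all× =
    ZM.zeroSumFree-¬¬ finM ¬allM λ (xs , |xs| , ¬zxs) →
    ZN.zeroSumFree-¬¬ finN ¬allN λ (ys , |ys| , ¬zys) →
    ¬consecZeroSum-fromBlock ys ¬zys xs ys ¬zxs ¬zys (Z×.hasConsecZeroSum⇒ (all× (interleave ys xs)
      (trans (length-interleave ys xs) (cong₂ (λ q p → q + p * suc q) |ys| |xs|))))

mainTheorem10 : {r ℓr m ℓm n ℓn a : Level} (R : Ring r ℓr)
    (M : LeftModule R m ℓm) (N : LeftModule R n ℓn) (A : Pred (Ring.Carrier R) a) →
    IsFiniteModule M → IsFiniteModule N →
    (cM cN cMN : ℕ) → IsC M A cM → IsC N A cN → IsC (leftModule M N) A cMN →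
    cM * cN ≤ cMN
mainTheorem10 R M N A finM finN (suc p) (suc q) cMN isC-M isC-N (_ , all× , _) =
  decidable-stable (suc p * suc q ≤? cMN) λ pq≰cMN →
    Interleaving.¬allHaveZS-× M N A finM finN
      (WeightedSums.isC⇒¬allHaveZS M A isC-M (n<1+n p))
      (WeightedSums.isC⇒¬allHaveZS N A isC-N (n<1+n q))
      (WeightedSums.allHaveZS-mono (leftModule M N) A (≤-pred (≰⇒> pq≰cMN)) all×)
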